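{- Define, for $n\in\mathbb N$, $$p_1(n) := 3 + \min\Big( \big(3\cdot (n+2)!\big) \bmod (n+3),\ \big(3\cdot (n+4)!\big) \bmod (n+5)\Big), \qquad p_2(n) := p_1(n)+2.$$ Then: (i) For every $n\in\mathbb N$, $(p_1(n),p_2(n))$ is a twin-prime pair. (ii) Every twin-prime pair equals $(p_1(n),p_2(n))$ for some $n\in\mathbb N$.
   Context: $\mathbb N=\{0,1,2,\dots\}$. For natural numbers $a$ and $b\ge1$, $a \bmod b$ denotes the remainder of $a$ upon division by $b$. A twin-prime pair is a pair $(p,p+2)$ of natural numbers such that both $p$ and $p+2$ are prime. -}

module Defs where

open import Data.Nat using (ℕ; _+_; _*_; _⊓_; _!)
open import Data.Nat.DivMod using (_%_)
open import Data.Nat.Primality using (Prime)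
open import Data.Product using (_×_)

p₁ : ℕ → ℕ
p₁ n = 3 + (((3 * ((n + 2) !)) % (3 + n)) ⊓ ((3 * ((n + 4) !)) % (5 + n)))

p₂ : ℕ → ℕ
p₂ n = p₁ n + 2

TwinPrime : ℕ → Set
TwinPrime p = Prime p × Prime (p + 2)

-- Wilson's theorem gives 3 · k! ≡ -3 (mod k + 1) whenever k + 1 is prime, while k + 1 ∣ k! whenever
-- k + 1 is composite and different from 4. Hence the two residues in p₁ n are n and n + 2 when
-- n + 3 and n + 5 are both prime, and otherwise one of them is 0. So p₁ n is n + 3 in the first
-- case and 3 in the second, and every twin pair (p, p + 2), necessarily with p ≥ 3, is reached
-- from n = p - 3. Wilson's theorem itself follows by pairing every element of {2, …, p - 2} with
-- its (different) inverse modulo p.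
module Submission where

open import Defs
open import Level using (0ℓ)
open import Algebra.Bundles using (CommutativeMonoid)
open import Data.Nat
open import Data.Nat.Properties
open import Data.Nat.DivMod
open import Data.Nat.Divisibility
open import Data.Nat.Primality
open import Data.Nat.Coprimality using (Coprime; coprime?; coprime-Bézout; prime⇒coprime)
open import Data.Nat.GCD using (module Bézout)
open import Data.Nat.Tactic.RingSolver using (solve-∀)
open import Data.List.Fresh using (List#; []; cons; _∷#_; _#_; length)
open import Data.List.Fresh.Relation.Unary.Any using (here; there; _─_)
open import Data.List.Fresh.Relation.Unary.Any.Properties using (length-remove)
open import Data.Product using (_×_; _,_; proj₁; proj₂; ∃-syntax)
open import Data.Sum using (_⊎_; inj₁; inj₂; [_,_]′)
open import Function using (id; _∘_)
open import Relation.Binary.Core using (Rel)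
open import Relation.Binary.Definitions using (tri<; tri≈; tri>)
open import Relation.Binary.PropositionalEquality as ≡ using (_≡_; _≢_; refl; cong; cong₂; subst)
import Relation.Binary.Construct.On as On
open import Relation.Nullary using (¬_; yes; no; contradiction)
open import Relation.Nullary.Decidable using (_×-dec_; toWitness)

module _ {a r} {A : Set a} {R : Rel A r} where
  open import Data.List.Fresh.Membership.Setoid (≡.setoid A) using (_∈_)

  ∈-─⁻ : ∀ {x y} {xs : List# A R} (x∈xs : x ∈ xs) → y ∈ (xs ─ x∈xs) → y ∈ xs
  ∈-─⁻ (here _)     y∈         = there y∈
  ∈-─⁻ (there x∈xs) (here y≡)  = here y≡
  ∈-─⁻ (there x∈xs) (there y∈) = there (∈-─⁻ x∈xs y∈)

module DistinctProduct {c ℓ} (M : CommutativeMonoid c ℓ) where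

  open CommutativeMonoid M hiding (refl)
  module Eq = CommutativeMonoid M using (refl)
  open import Relation.Binary.Reasoning.Setoid setoid
  open import Algebra.Properties.CommutativeSemigroup commutativeSemigroup using (x∙yz≈y∙xz)
  open import Data.List.Fresh.Membership.Setoid (≡.setoid Carrier) using (_∈_)
  open import Data.List.Fresh.Membership.Setoid.Properties (≡.setoid Carrier)
    using (fresh⇒∉; ∈-remove; ∉-remove)

  Distinct : Set c
  Distinct = List# Carrier _≢_

  ∏ : Distinct → Carrier
  ∏ []        = ε
  ∏ (x ∷# xs) = x ∙ ∏ xs

  ∏-─ : ∀ {x} {xs : Distinct} (x∈xs : x ∈ xs) → ∏ xs ≈ x ∙ ∏ (xs ─ x∈xs)
  ∏-─ (here refl)                = Eq.refl
  ∏-─ {x} {y ∷# ys} (there x∈ys) = begin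
    y ∙ ∏ ys               ≈⟨ ∙-congˡ (∏-─ x∈ys) ⟩
    y ∙ (x ∙ ∏ (ys ─ x∈ys)) ≈⟨ x∙yz≈y∙xz y x _ ⟩
    x ∙ (y ∙ ∏ (ys ─ x∈ys)) ∎

  record PairedByInverses (f : Carrier → Carrier) (xs : Distinct) : Set (c Level.⊔ ℓ) where
    field
      closed       : ∀ {x} → x ∈ xs → f x ∈ xs
      fixpointFree : ∀ {x} → x ∈ xs → f x ≢ x
      involutive   : ∀ {x} → x ∈ xs → f (f x) ≡ x
      inverse      : ∀ {x} → x ∈ xs → x ∙ f x ≈ ε

  module _ {f : Carrier → Carrier} {a : Carrier} {as : Distinct} {a#as : a # as}
           (P : PairedByInverses f (cons a as a#as)) where
    open PairedByInverses P

    partner∈ : f a ∈ as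
    partner∈ with closed (here refl)
    ... | here fa≡a   = contradiction fa≡a (fixpointFree (here refl))
    ... | there fa∈as = fa∈as

    removePair : PairedByInverses f (as ─ partner∈)
    removePair = record
      { closed       = λ y∈ → ∈-remove partner∈ (f-inTail y∈) (fa≢fy y∈)
      ; fixpointFree = fixpointFree ∘ there ∘ inTail
      ; involutive   = involutive ∘ there ∘ inTail
      ; inverse      = inverse ∘ there ∘ inTail
      }
      where
      inTail : ∀ {y} → y ∈ (as ─ partner∈) → y ∈ as
      inTail = ∈-─⁻ partner∈

      f-inTail : ∀ {y} → y ∈ (as ─ partner∈) → f y ∈ as
      f-inTail y∈ with closed (there (inTail y∈))
      ... | here fy≡a   = contradiction
        (subst (_∈ (as ─ partner∈))
          (≡.trans (≡.sym (involutive (there (inTail y∈)))) (cong f fy≡a)) y∈)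
        (∉-remove id id partner∈)
      ... | there fy∈as = fy∈as

      fa≢fy : ∀ {y} → y ∈ (as ─ partner∈) → f a ≢ f y
      fa≢fy y∈ fa≡fy = fresh⇒∉ id a#as (subst (_∈ as) (≡.sym a≡y) (inTail y∈))
        where
        a≡y = ≡.trans (≡.sym (involutive (here refl)))
                      (≡.trans (cong f fa≡fy) (involutive (there (inTail y∈))))

  pairedByInverses⇒∏≈ε : ∀ {f} {xs : Distinct} → PairedByInverses f xs → ∏ xs ≈ ε
  pairedByInverses⇒∏≈ε {f} {xs} = go (length xs) ≤-refl
    where
    go : ∀ {ys} n → length ys ≤ n → PairedByInverses f ys → ∏ ys ≈ ε
    go {[]}             _       _        _ = Eq.refl
    go {cons a as a#as} (suc n) (s≤s ≤n) P = begin
      a ∙ ∏ as           ≈⟨ ∙-congˡ (∏-─ (partner∈ P)) ⟩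
      a ∙ (f a ∙ ∏ rest) ≈⟨ assoc a (f a) (∏ rest) ⟨
      (a ∙ f a) ∙ ∏ rest ≈⟨ ∙-cong (PairedByInverses.inverse P (here refl))
                                   (go n rest≤n (removePair P)) ⟩
      ε ∙ ε              ≈⟨ identityˡ ε ⟩
      ε                  ∎
      where
      rest = as ─ partner∈ P
      rest≤n : length rest ≤ n
      rest≤n = ≤-trans (n≤1+n _) (subst (_≤ n) (length-remove (partner∈ P)) ≤n)

*-mod-commutativeMonoid : (m : ℕ) .{{_ : NonZero m}} → CommutativeMonoid 0ℓ 0ℓ
*-mod-commutativeMonoid m = record
  { Carrier             = ℕ
  ; _≈_                 = λ a b → a % m ≡ b % m
  ; _∙_                 = _*_
  ; ε                   = 1
  ; isCommutativeMonoid = record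
    { isMonoid = record
      { isSemigroup = record
        { isMagma = record
          { isEquivalence = On.isEquivalence (_% m) ≡.isEquivalence
          ; ∙-cong        = *-cong
          }
        ; assoc       = λ a b c → cong (_% m) (*-assoc a b c)
        }
      ; identity    = (λ a → cong (_% m) (*-identityˡ a)) , (λ a → cong (_% m) (*-identityʳ a))
      }
    ; comm     = λ a b → cong (_% m) (*-comm a b)
    }
  }
  where
  *-cong : ∀ {a b c d} → a % m ≡ b % m → c % m ≡ d % m → a * c % m ≡ b * d % m
  *-cong {a} {b} {c} {d} a≈b c≈d = begin
    a * c % m             ≡⟨ %-distribˡ-* a c m ⟩
    (a % m) * (c % m) % m ≡⟨ cong₂ (λ u v → u * v % m) a≈b c≈d ⟩
    (b % m) * (d % m) % m ≡⟨ %-distribˡ-* b d m ⟨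
    b * d % m             ∎
    where open ≡.≡-Reasoning

module ModularInverse (q : ℕ) where

  m : ℕ
  m = suc q

  open CommutativeMonoid (*-mod-commutativeMonoid m)
    using (_≈_; setoid; ∙-congˡ; ∙-congʳ; assoc; comm; identityˡ; identityʳ)
  open import Relation.Binary.Reasoning.Setoid setoid

  residue-injective : ∀ {x y} → x < m → y < m → x ≈ y → x ≡ y
  residue-injective x<m y<m x≈y = ≡.trans (≡.sym (m<n⇒m%n≡m x<m)) (≡.trans x≈y (m<n⇒m%n≡m y<m))

  -- In the +- case x b ≡ -1, and q ≡ -1 (mod m).
  bézoutInverse : ∀ {x} → Bézout.Identity 1 m x → ℕ
  bézoutInverse (Bézout.+- _ b _) = b * q
  bézoutInverse (Bézout.-+ _ b _) = b

  bézoutInverse-inverseʳ : ∀ {x} (i : Bézout.Identity 1 m x) → x * bézoutInverse i ≈ 1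
  bézoutInverse-inverseʳ {x} (Bézout.+- a b 1+bx≡am) = begin
    x * (b * q)         ≈⟨ %-remove-+ʳ (x * (b * q)) {m} ∣-refl ⟨
    x * (b * q) + m     ≡⟨ expand x b q ⟩
    1 + (1 + b * x) * q ≡⟨ cong (λ t → 1 + t * q) 1+bx≡am ⟩
    1 + (a * m) * q     ≡⟨ cong (1 +_) (*-comm (a * m) q) ⟩
    1 + q * (a * m)     ≈⟨ %-remove-+ʳ 1 {q * (a * m)} {m} (∣-trans (n∣m*n a) (n∣m*n q)) ⟩
    1                   ∎
    where
    expand : ∀ x b q → x * (b * q) + suc q ≡ 1 + (1 + b * x) * q
    expand = solve-∀
  bézoutInverse-inverseʳ {x} (Bézout.-+ a b 1+am≡bx) = begin
    x * b     ≡⟨ ≡.trans (*-comm x b) (≡.sym 1+am≡bx) ⟩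
    1 + a * m ≈⟨ %-remove-+ʳ 1 {a * m} {m} (n∣m*n a) ⟩
    1         ∎

  _⁻¹ : ℕ → ℕ
  x ⁻¹ with coprime? m x
  ... | yes m⊥x = bézoutInverse (coprime-Bézout m⊥x) % m
  ... | no  _   = 0

  ⁻¹<m : ∀ x → x ⁻¹ < m
  ⁻¹<m x with coprime? m x
  ... | yes m⊥x = m%n<n (bézoutInverse (coprime-Bézout m⊥x)) m
  ... | no  _   = z<s

  inverseʳ : ∀ {x} → Coprime m x → x * x ⁻¹ ≈ 1
  inverseʳ {x} m⊥x with coprime? m x
  ... | yes m⊥x′ = begin
    x * (bézoutInverse b % m) ≈⟨ ∙-congˡ {x} (m%n%n≡m%n (bézoutInverse b) m) ⟩
    x * bézoutInverse b       ≈⟨ bézoutInverse-inverseʳ b ⟩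
    1                         ∎
    where b = coprime-Bézout m⊥x′
  ... | no ¬m⊥x = contradiction (λ {d} → m⊥x {d}) ¬m⊥x

  ⁻¹-unique : ∀ {x y} → Coprime m x → y < m → x * y ≈ 1 → y ≡ x ⁻¹
  ⁻¹-unique {x} {y} m⊥x y<m xy≈1 = residue-injective y<m (⁻¹<m x) (begin
    y              ≈⟨ identityʳ y ⟨
    y * 1          ≈⟨ ∙-congˡ {y} {x * x ⁻¹} {1} (inverseʳ m⊥x) ⟨
    y * (x * x ⁻¹) ≈⟨ assoc y x (x ⁻¹) ⟨
    (y * x) * x ⁻¹ ≈⟨ ∙-congʳ {x ⁻¹} {y * x} {1} (≡.trans (comm y x) xy≈1) ⟩
    1 * x ⁻¹       ≈⟨ identityˡ (x ⁻¹) ⟩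
    x ⁻¹           ∎)

open import Data.List.Fresh.Membership.Setoid (≡.setoid ℕ) using (_∈_)

twoUpTo : ℕ → List# ℕ _≢_
twoUpTo-# : ∀ {j} k → k < j → j # twoUpTo k

twoUpTo 0             = []
twoUpTo 1             = []
twoUpTo (suc (suc k)) = cons (2 + k) (twoUpTo (suc k)) (twoUpTo-# (suc k) ≤-refl)

twoUpTo-# 0             _   = _
twoUpTo-# 1             _   = _
twoUpTo-# (suc (suc k)) k<j = >⇒≢ k<j , twoUpTo-# (suc k) (<⇒≤ k<j)

∈-twoUpTo⁻ : ∀ {x} k → x ∈ twoUpTo k → 2 ≤ x × x ≤ k
∈-twoUpTo⁻ (suc (suc k)) (here refl) = s≤s (s≤s z≤n) , ≤-refl
∈-twoUpTo⁻ (suc (suc k)) (there x∈) with ∈-twoUpTo⁻ (suc k) x∈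
... | 2≤x , x≤1+k = 2≤x , m≤n⇒m≤1+n x≤1+k

∈-twoUpTo⁺ : ∀ {x} k → 2 ≤ x → x ≤ k → x ∈ twoUpTo k
∈-twoUpTo⁺ 0             (s≤s (s≤s _)) ()
∈-twoUpTo⁺ 1             (s≤s (s≤s _)) (s≤s ())
∈-twoUpTo⁺ (suc (suc k)) 2≤x           x≤2+k =
  [ there ∘ ∈-twoUpTo⁺ (suc k) 2≤x ∘ ≤-pred , here ]′ (m≤n⇒m<n∨m≡n x≤2+k)

module WilsonProof (r : ℕ) (p-prime : Prime (2 + r)) where

  open ModularInverse (suc r)
  open CommutativeMonoid (*-mod-commutativeMonoid m) using (_≈_; ∙-congˡ; comm)
  open DistinctProduct (*-mod-commutativeMonoid m)
    using (∏; PairedByInverses; pairedByInverses⇒∏≈ε)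

  coprime : ∀ {x} → 0 < x → x < m → Coprime m x
  coprime 0<x x<m = prime⇒coprime p-prime {{>-nonZero 0<x}} x<m

  ⁻¹-positive : ∀ {x} → 0 < x → x < m → 0 < x ⁻¹
  ⁻¹-positive {x} 0<x x<m = n≢0⇒n>0 λ x⁻¹≡0 → 0≢1+n (begin
    0            ≡⟨ cong (_% m) (*-zeroʳ x) ⟨
    x * 0 % m    ≡⟨ cong (λ y → x * y % m) x⁻¹≡0 ⟨
    x * x ⁻¹ % m ≡⟨ inverseʳ (coprime 0<x x<m) ⟩
    1            ∎)
    where open ≡.≡-Reasoning

  ⁻¹-involutive : ∀ {x} → 0 < x → x < m → x ⁻¹ ⁻¹ ≡ x
  ⁻¹-involutive {x} 0<x x<m =
    ≡.sym (⁻¹-unique {x ⁻¹} {x} (coprime (⁻¹-positive 0<x x<m) (⁻¹<m x)) x<m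
      (≡.trans (comm (x ⁻¹) x) (inverseʳ (coprime 0<x x<m))))

  1+k≈1⇒m∣k : ∀ k → 1 + k ≈ 1 → m ∣ k
  1+k≈1⇒m∣k k 1+k≈1 = divides ((1 + k) / m) (suc-injective (begin
    1 + k                         ≡⟨ m≡m%n+[m/n]*n (1 + k) m ⟩
    (1 + k) % m + (1 + k) / m * m ≡⟨ cong (_+ (1 + k) / m * m) 1+k≈1 ⟩
    1 + (1 + k) / m * m           ∎))
    where open ≡.≡-Reasoning

  -- (1 + y)² ≡ 1 + y (2 + y), and the prime m divides one of the two factors.
  square≈1⇒±1 : ∀ {x} → 0 < x → x < m → x * x ≈ 1 → x ≡ 1 ⊎ x ≡ 1 + r
  square≈1⇒±1 {suc y} _ x<m x²≈1
    with euclidsLemma y (2 + y) p-prime (1+k≈1⇒m∣k (y * (2 + y)) 1+y[2+y]≈1)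
    where
    expand : ∀ y → 1 + y * (2 + y) ≡ suc y * suc y
    expand = solve-∀
    1+y[2+y]≈1 : 1 + y * (2 + y) ≈ 1
    1+y[2+y]≈1 = ≡.trans (cong (_% m) (expand y)) x²≈1
  ... | inj₁ m∣y   = inj₁ (cong suc (m∣n<m⇒n≡0 m∣y (<-trans (n<1+n y) x<m)))
    where
    m∣n<m⇒n≡0 : ∀ {n} → m ∣ n → n < m → n ≡ 0
    m∣n<m⇒n≡0 {zero}  _   _   = refl
    m∣n<m⇒n≡0 {suc n} m∣n n<m = contradiction (∣⇒≤ m∣n) (<⇒≱ n<m)
  ... | inj₂ m∣2+y = inj₂ (suc-injective (≤-antisym x<m (∣⇒≤ m∣2+y)))

  ±1-selfInverse : ∀ {x} → x ≡ 1 ⊎ x ≡ 1 + r → x ⁻¹ ≡ x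
  ±1-selfInverse (inj₁ refl) = ≡.sym (⁻¹-unique (coprime z<s (s<s z<s)) (s<s z<s) refl)
  ±1-selfInverse (inj₂ refl) = ≡.sym (⁻¹-unique (coprime z<s ≤-refl) ≤-refl square≈1)
    where
    expand : ∀ r → (1 + r) * (1 + r) ≡ 1 + r * (2 + r)
    expand = solve-∀
    square≈1 : (1 + r) * (1 + r) ≈ 1
    square≈1 = ≡.trans (cong (_% m) (expand r)) (%-remove-+ʳ 1 {r * m} {m} (n∣m*n r))

  twoUpTo-pairedByInverses : PairedByInverses _⁻¹ (twoUpTo r)
  twoUpTo-pairedByInverses = record
    { closed       = closed
    ; fixpointFree = λ {x} x∈ x⁻¹≡x →
        ¬±1 x∈ (square≈1⇒±1 (pos x∈) (bound x∈) (subst (λ y → x * y ≈ 1) x⁻¹≡x (inverse x∈)))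
    ; involutive   = λ x∈ → ⁻¹-involutive (pos x∈) (bound x∈)
    ; inverse      = inverse
    }
    where
    pos : ∀ {x} → x ∈ twoUpTo r → 0 < x
    pos x∈ = <-trans z<s (proj₁ (∈-twoUpTo⁻ r x∈))

    bound : ∀ {x} → x ∈ twoUpTo r → x < m
    bound x∈ = m≤n⇒m≤1+n (s≤s (proj₂ (∈-twoUpTo⁻ r x∈)))

    inverse : ∀ {x} → x ∈ twoUpTo r → x * x ⁻¹ ≈ 1
    inverse x∈ = inverseʳ (coprime (pos x∈) (bound x∈))

    ¬±1 : ∀ {x} → x ∈ twoUpTo r → ¬ (x ≡ 1 ⊎ x ≡ 1 + r)
    ¬±1 x∈ (inj₁ refl) = <-irrefl refl (proj₁ (∈-twoUpTo⁻ r x∈))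
    ¬±1 x∈ (inj₂ refl) = <-irrefl refl (s≤s (proj₂ (∈-twoUpTo⁻ r x∈)))

    -- ±1 are their own inverses, so an inverse equal to ±1 would force x itself to be ±1.
    closed : ∀ {x} → x ∈ twoUpTo r → x ⁻¹ ∈ twoUpTo r
    closed {x} x∈ = ∈-twoUpTo⁺ r
      (≤∧≢⇒< (⁻¹-positive (pos x∈) (bound x∈)) (λ 1≡x⁻¹ → x⁻¹≢±1 (inj₁ (≡.sym 1≡x⁻¹))))
      (≤-pred (≤∧≢⇒< (≤-pred (⁻¹<m x)) (x⁻¹≢±1 ∘ inj₂)))
      where
      x⁻¹≢±1 : ¬ (x ⁻¹ ≡ 1 ⊎ x ⁻¹ ≡ 1 + r)
      x⁻¹≢±1 ±1 = ¬±1 x∈ (subst (λ y → y ≡ 1 ⊎ y ≡ 1 + r)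
        (≡.trans (≡.sym (±1-selfInverse ±1)) (⁻¹-involutive (pos x∈) (bound x∈))) ±1)

  ∏-twoUpTo : ∀ k → ∏ (twoUpTo k) ≡ k !
  ∏-twoUpTo 0             = refl
  ∏-twoUpTo 1             = refl
  ∏-twoUpTo (suc (suc k)) = cong ((2 + k) *_) (∏-twoUpTo (suc k))

  [1+r]!≡1+r : (1 + r) ! % m ≡ 1 + r
  [1+r]!≡1+r = begin
    (1 + r) * r ! % m ≡⟨ ∙-congˡ {1 + r} {r !} {1} r!≈1 ⟩
    (1 + r) * 1 % m   ≡⟨ cong (_% m) (*-identityʳ (1 + r)) ⟩
    (1 + r) % m       ≡⟨ m<n⇒m%n≡m ≤-refl ⟩
    1 + r             ∎
    where
    open ≡.≡-Reasoning
    r!≈1 : r ! ≈ 1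
    r!≈1 = subst (_≈ 1) (∏-twoUpTo r) (pairedByInverses⇒∏≈ε twoUpTo-pairedByInverses)

wilson : ∀ {n} → Prime (suc n) → n ! % suc n ≡ n
wilson {zero}  1-prime = contradiction 1-prime ¬prime[1]
wilson {suc r} p-prime = WilsonProof.[1+r]!≡1+r r p-prime

0<m≤n⇒m∣n! : ∀ {m n} → 0 < m → m ≤ n → m ∣ n !
0<m≤n⇒m∣n! {suc m} _ 1+m≤n = ∣-trans (m∣m*n (m !)) (m≤n⇒m!∣n! 1+m≤n)

0<m<n≤o⇒m*n∣o! : ∀ {m n o} → 0 < m → m < n → n ≤ o → m * n ∣ o !
0<m<n≤o⇒m*n∣o! {m} {suc n} 0<m m<1+n 1+n≤o = ∣-trans
  (subst (m * suc n ∣_) (*-comm (n !) (suc n))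
    (*-monoˡ-∣ (suc n) (0<m≤n⇒m∣n! 0<m (≤-pred m<1+n))))
  (m≤n⇒m!∣n! 1+n≤o)

-- For d ≥ 3 the distinct factors d < 2d both lie below d².
square∣! : ∀ {n d} → 2 < d → suc n ≡ d * d → suc n ∣ n !
square∣! {n} {d@(suc (suc (suc t)))} (s≤s (s≤s (s≤s _))) 1+n≡d*d =
  subst (_∣ n !) (≡.sym 1+n≡d*d)
    (∣-trans (*-monoʳ-∣ d (n∣m*n 2 {d})) (0<m<n≤o⇒m*n∣o! z<s d<2*d 2*d≤n))
  where
  d<2*d : d < 2 * d
  d<2*d = m<m+n d z<s
  expand : ∀ t → (3 + t) * (3 + t) ≡ suc (2 * (3 + t)) + (2 + t * (4 + t))
  expand = solve-∀
  2*d≤n : 2 * d ≤ n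
  2*d≤n = ≤-pred (subst (suc (2 * d) ≤_) (≡.sym (≡.trans 1+n≡d*d (expand t))) (m≤m+n _ _))

composite⇒∣! : ∀ {n} → Composite (suc n) → suc n ≢ 4 → suc n ∣ n !
composite⇒∣! (composite _ (divides zero ()))
composite⇒∣! {n} (composite {d} d<1+n (divides e@(suc _) 1+n≡e*d)) 1+n≢4 with <-cmp d e
... | tri< d<e _ _ = subst (_∣ n !) (≡.trans (*-comm d e) (≡.sym 1+n≡e*d))
                       (0<m<n≤o⇒m*n∣o! (<-trans z<s 1<d) d<e e≤n)
  where
  1<d = nonTrivial⇒n>1 d
  e≤n : e ≤ n
  e≤n = ≤-pred (subst (e <_) (≡.sym 1+n≡e*d) (m<m*n e d 1<d))
... | tri> _ _ e<d = subst (_∣ n !) (≡.sym 1+n≡e*d) (0<m<n≤o⇒m*n∣o! z<s e<d (≤-pred d<1+n))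
... | tri≈ _ refl _ = square∣! (≤∧≢⇒< (nonTrivial⇒n>1 d) 2≢d) 1+n≡e*d
  where
  2≢d : 2 ≢ d
  2≢d 2≡d = 1+n≢4 (≡.trans 1+n≡e*d (cong (λ x → x * x) (≡.sym 2≡d)))

residue : ℕ → ℕ
residue k = 3 * k ! % suc k

residue-prime : ∀ n → Prime (3 + n) → residue (2 + n) ≡ n
residue-prime n p-prime = begin
  3 * (2 + n) ! % (3 + n)     ≡⟨ ∙-congˡ {3} {(2 + n) !} {2 + n}
                                   (≡.trans (wilson p-prime) (≡.sym (m<n⇒m%n≡m ≤-refl))) ⟩
  3 * (2 + n) % (3 + n)       ≡⟨ cong (_% (3 + n)) (expand n) ⟩
  (n + 2 * (3 + n)) % (3 + n) ≡⟨ %-remove-+ʳ n {2 * (3 + n)} {3 + n} (n∣m*n 2) ⟩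
  n % (3 + n)                 ≡⟨ m<n⇒m%n≡m (m≤n+m (suc n) 2) ⟩
  n                           ∎
  where
  open ≡.≡-Reasoning
  open CommutativeMonoid (*-mod-commutativeMonoid (3 + n)) using (∙-congˡ)
  expand : ∀ n → 3 * (2 + n) ≡ n + 2 * (3 + n)
  expand = solve-∀

residue-composite : ∀ {k} → Composite (suc k) → suc k ≢ 4 → residue k ≡ 0
residue-composite {k} 1+k-composite 1+k≢4 =
  n∣m⇒m%n≡0 (3 * k !) (suc k) (∣n⇒∣m*n 3 (composite⇒∣! 1+k-composite 1+k≢4))

p₁≡3+residues : ∀ n → p₁ n ≡ 3 + residue (2 + n) ⊓ residue (4 + n)
p₁≡3+residues n =
  cong₂ (λ a b → 3 + (3 * a ! % (3 + n)) ⊓ (3 * b ! % (5 + n))) (+-comm n 2) (+-comm n 4)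

p₁-twin : ∀ n → Prime (3 + n) → Prime (5 + n) → p₁ n ≡ 3 + n
p₁-twin n p-prime q-prime = begin
  p₁ n                                  ≡⟨ p₁≡3+residues n ⟩
  3 + residue (2 + n) ⊓ residue (4 + n) ≡⟨ cong₂ (λ a b → 3 + a ⊓ b)
                                             (residue-prime n p-prime) (residue-prime (2 + n) q-prime) ⟩
  3 + n ⊓ (2 + n)                       ≡⟨ cong (3 +_) (m≤n⇒m⊓n≡m (m≤n+m n 2)) ⟩
  3 + n                                 ∎
  where open ≡.≡-Reasoning

-- n = 1 is the one case where 3 + n = 4 is composite; there 5 + n = 6 is composite too.
nonTwin⇒residue≡0 : ∀ n → ¬ (Prime (3 + n) × Prime (5 + n)) →
                    residue (2 + n) ≡ 0 ⊎ residue (4 + n) ≡ 0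
nonTwin⇒residue≡0 n ¬twin with prime? (5 + n)
... | no ¬q-prime = inj₂ (residue-composite (¬prime⇒composite ¬q-prime) λ ())
... | yes q-prime =
  inj₁ (residue-composite (¬prime⇒composite λ p-prime → ¬twin (p-prime , q-prime)) 3+n≢4)
  where
  3+n≢4 : 3 + n ≢ 4
  3+n≢4 3+n≡4 = composite⇒¬prime composite[6] (subst (λ x → Prime (2 + x)) 3+n≡4 q-prime)

p₁-nonTwin : ∀ n → ¬ (Prime (3 + n) × Prime (5 + n)) → p₁ n ≡ 3
p₁-nonTwin n ¬twin = ≡.trans (p₁≡3+residues n) (cong (3 +_) (⊓≡0 (nonTwin⇒residue≡0 n ¬twin)))
  where
  ⊓≡0 : ∀ {a b} → a ≡ 0 ⊎ b ≡ 0 → a ⊓ b ≡ 0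
  ⊓≡0     (inj₁ refl) = refl
  ⊓≡0 {a} (inj₂ refl) = ⊓-zeroʳ a

twinPrime[3+n] : ∀ {n} → Prime (3 + n) → Prime (5 + n) → TwinPrime (3 + n)
twinPrime[3+n] {n} p-prime q-prime = p-prime , subst Prime (+-comm 2 (3 + n)) q-prime

p₁-twinPrime : ∀ n → TwinPrime (p₁ n)
p₁-twinPrime n with prime? (3 + n) ×-dec prime? (5 + n)
... | yes (p-prime , q-prime) =
  subst TwinPrime (≡.sym (p₁-twin n p-prime q-prime)) (twinPrime[3+n] p-prime q-prime)
... | no ¬twin =
  subst TwinPrime (≡.sym (p₁-nonTwin n ¬twin)) (twinPrime[3+n] {0} prime[3] prime[5])
  where
  prime[3] : Prime 3
  prime[3] = toWitness {a? = prime? 3} _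
  prime[5] : Prime 5
  prime[5] = toWitness {a? = prime? 5} _

twinPrime⇒p₁ : ∀ p → TwinPrime p → ∃[ n ] p₁ n ≡ p
twinPrime⇒p₁ 0 (0-prime , _) = contradiction 0-prime ¬prime[0]
twinPrime⇒p₁ 1 (1-prime , _) = contradiction 1-prime ¬prime[1]
twinPrime⇒p₁ 2 (_ , 4-prime) = contradiction 4-prime (composite⇒¬prime composite[4])
twinPrime⇒p₁ (suc (suc (suc n))) (p-prime , q-prime) =
  n , p₁-twin n p-prime (subst Prime (+-comm (3 + n) 2) q-prime)

mainTheorem2 : ((n : ℕ) → Prime (p₁ n) × Prime (p₂ n))
               × ((p : ℕ) → TwinPrime p → ∃[ n ] (p₁ n ≡ p × p₂ n ≡ p + 2))
mainTheorem2 = p₁-twinPrime , λ p twin →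
  let (n , p₁n≡p) = twinPrime⇒p₁ p twin in n , p₁n≡p , cong (_+ 2) p₁n≡p
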